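{- Let $A$ be a nonnegative symmetric $n\times n$ real matrix with ppr-sequence $r_0r_1\cdots r_n$. If $r_{2k}=0$ for some integer $k>0$ (with $2k\le n$), then $r_j=0$ for all $j$ with $2k\le j\le n$.
   Context: The permanent of an $m\times m$ matrix is ${\rm per}(A)=\sum_{\sigma\in S_m}\prod_{i=1}^m a_{i\sigma(i)}$. The ppr-sequence of an $n\times n$ matrix $A$ is $r_0r_1\cdots r_n$ where, for $1\le k\le n$, $r_k=1$ iff $A$ has a principal submatrix of size $k$ with nonzero permanent (else $0$), and $r_0=1$ iff $A$ has a zero entry on its main diagonal. -}

module Defs where

open import Level using (Level; _⊔_) renaming (suc to lsuc)
open import Algebra.Bundles using (CommutativeRing)
open import Data.Nat using (ℕ; zero; suc)
open import Data.Fin using (Fin; _<_) renaming (zero to fzero; suc to fsuc)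
open import Data.Fin.Properties using (all?; _≟_)
open import Data.List using (List; []; _∷_; map; concatMap; filter; foldr; allFin)
open import Data.Product using (Σ; ∃; _×_; _,_)
open import Data.Vec.Functional as VF using ()
open import Relation.Binary.Core using (Rel)
open import Relation.Binary.Structures using (IsTotalOrder)
open import Relation.Binary.PropositionalEquality using (_≡_)
open import Relation.Nullary using (¬_; Dec)
open import Relation.Nullary.Decidable using (_→-dec_)

record OrderedField (c ℓ₁ ℓ₂ : Level) : Set (lsuc (c ⊔ ℓ₁ ⊔ ℓ₂)) where
  field
    commutativeRing : CommutativeRing c ℓ₁
  open CommutativeRing commutativeRing public
  field
    _≤_          : Rel Carrier ℓ₂
    isTotalOrder : IsTotalOrder _≈_ _≤_
    +-monoˡ-≤    : ∀ {a b} c → a ≤ b → (a + c) ≤ (b + c)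
    *-nonneg     : ∀ {a b} → 0# ≤ a → 0# ≤ b → 0# ≤ (a * b)
    0≉1          : ¬ (0# ≈ 1#)
    inverse      : ∀ x → ¬ (x ≈ 0#) → ∃ λ y → (x * y) ≈ 1#

allFuns : (m k : ℕ) → List (Fin m → Fin k)
allFuns zero    k = (λ ()) ∷ []
allFuns (suc m) k =
  concatMap (λ f → map (λ x → x VF.∷ f) (allFin k)) (allFuns m k)

IsPerm : {m : ℕ} → (Fin m → Fin m) → Set
IsPerm σ = ∀ i j → σ i ≡ σ j → i ≡ j

isPerm? : {m : ℕ} (σ : Fin m → Fin m) → Dec (IsPerm σ)
isPerm? σ = all? (λ i → all? (λ j → (σ i ≟ σ j) →-dec (i ≟ j)))

permutations : (m : ℕ) → List (Fin m → Fin m)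
permutations m = filter isPerm? (allFuns m m)

module Matrices {c ℓ : Level} (R : CommutativeRing c ℓ) where
  open CommutativeRing R

  Matrix : ℕ → Set c
  Matrix n = Fin n → Fin n → Carrier

  sumL : List Carrier → Carrier
  sumL = foldr _+_ 0#

  prodFin : (m : ℕ) → (Fin m → Carrier) → Carrier
  prodFin zero    f = 1#
  prodFin (suc m) f = f fzero * prodFin m (λ i → f (fsuc i))

  per : {m : ℕ} → Matrix m → Carrier
  per {m} A = sumL (map (λ σ → prodFin m (λ i → A i (σ i))) (permutations m))

  StrictlyIncreasing : {k n : ℕ} → (Fin k → Fin n) → Set
  StrictlyIncreasing f = ∀ i j → i < j → f i < f j

  principalSub : {k n : ℕ} → Matrix n → (Fin k → Fin n) → Matrix k
  principalSub A f i j = A (f i) (f j)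

  -- r_k = 1  (as a proposition); "r_k = 0" is its negation
  ppr : {n : ℕ} → Matrix n → ℕ → Set ℓ
  ppr {n} A zero    = ∃ λ (i : Fin n) → A i i ≈ 0#
  ppr {n} A (suc k) = ∃ λ (f : Fin (suc k) → Fin n) →
                        StrictlyIncreasing f × ¬ (per (principalSub A f) ≈ 0#)

  SymmetricMatrix : {n : ℕ} → Matrix n → Set ℓ
  SymmetricMatrix A = ∀ i j → A i j ≈ A j i

-- The permanent of a nonnegative matrix is nonzero iff some permutation σ has all entries
-- a_{iσ(i)} nonzero. So r_j = 1 yields j indices and such a σ on them; as A is symmetric,
-- every edge i — σ(i) may be used in either direction. Among these indices one finds 2k
-- carrying such a permutation again, by recursion on a partial injection (initially σ): cut
-- a last edge p ↦ v off a path and keep the transposition (p v); if only cycles remain,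
-- either they have exactly the required size or deleting one point opens a cycle into a path.
-- The 2k indices then give a principal submatrix with nonzero permanent.

module Submission where

open import Defs
open import Level using (Level)
open import Data.Nat using (ℕ; zero; suc; _+_; _*_; _≤_; _<_; z≤n; s≤s)
open import Data.Bool using (Bool; true; false)
open import Data.Empty using (⊥-elim)
open import Data.Fin as Fin using (Fin) renaming (zero to fz; suc to fs)
import Data.Fin.Properties as Finₚ
open import Data.List using ([]; _∷_; map)
open import Data.List.Membership.Propositional.Properties using (∈-allFin)
open import Data.List.Relation.Unary.All using (lookupAny)
open import Data.List.Relation.Unary.All.Properties using (all-filter)
open import Data.List.Relation.Unary.Any as Any using (Any; here; there)
import Data.List.Relation.Unary.Any.Properties as Anyₚ
open import Data.Maybe using (Maybe; just; nothing; is-just)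
import Data.Maybe.Properties as Maybeₚ
open import Data.Nat.Induction using (<-wellFounded)
import Data.Nat.Properties as ℕₚ
open import Data.Product using (∃; ∃₂; _×_; _,_; proj₁; proj₂)
open import Data.Sum using (_⊎_; inj₁; inj₂)
open import Function using (_∘_; case_of_)
import Data.Vec.Functional as Vec
open import Induction.WellFounded using (Acc; acc)
open import Relation.Binary.Definitions using (tri<; tri≈; tri>)
open import Relation.Binary.PropositionalEquality
  using (_≡_; _≢_; refl; sym; trans; cong; cong₂; subst; module ≡-Reasoning)
open import Relation.Binary.Structures using (IsTotalOrder)
open import Relation.Nullary using (¬_; Dec; yes; no)
open import Relation.Nullary.Negation using (¬¬-map)

boolToℕ : Bool → ℕ
boolToℕ true  = 1
boolToℕ false = 0

count : ∀ {m} → (Fin m → Bool) → ℕ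
count {zero}  P = 0
count {suc m} P = boolToℕ (P fz) + count (P ∘ fs)

count-cong : ∀ {m} {P Q : Fin m → Bool} → (∀ x → P x ≡ Q x) → count P ≡ count Q
count-cong {zero}  P≗Q = refl
count-cong {suc m} P≗Q = cong₂ _+_ (cong boolToℕ (P≗Q fz)) (count-cong (P≗Q ∘ fs))

count-false : ∀ m → count {m} (λ _ → false) ≡ 0
count-false zero    = refl
count-false (suc m) = count-false m

count-true : ∀ m → count {m} (λ _ → true) ≡ m
count-true zero    = refl
count-true (suc m) = cong suc (count-true m)

count-remove : ∀ {m} {P Q : Fin m → Bool} i → P i ≡ true → Q i ≡ false →
               (∀ x → x ≢ i → Q x ≡ P x) → suc (count Q) ≡ count P
count-remove {suc m} fz Pi Qi Q≗P rewrite Pi | Qi =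
  cong suc (count-cong (λ x → Q≗P (fs x) λ ()))
count-remove {suc m} {P} (fs i) Pi Qi Q≗P rewrite Q≗P fz (λ ()) =
  trans (sym (ℕₚ.+-suc (boolToℕ (P fz)) _))
        (cong (boolToℕ (P fz) +_)
              (count-remove i Pi Qi (λ x x≢i → Q≗P (fs x) (x≢i ∘ Finₚ.suc-injective))))

count-nonempty : ∀ {m} (P : Fin m → Bool) → 0 < count P → ∃ λ x → P x ≡ true
count-nonempty {suc m} P 0<count with P fz in Pz
... | true  = fz , Pz
... | false with count-nonempty (P ∘ fs) 0<count
...   | x , Px = fs x , Px

PartialMap : ℕ → Set
PartialMap m = Fin m → Maybe (Fin m)

dom : ∀ {m} → PartialMap m → Fin m → Bool
dom π = is-just ∘ π

size : ∀ {m} → PartialMap m → ℕ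
size π = count (dom π)

IsInjective : ∀ {m} → PartialMap m → Set
IsInjective π = ∀ {i j k} → π i ≡ just k → π j ≡ just k → i ≡ j

IsClosed : ∀ {m} → PartialMap m → Set
IsClosed π = ∀ {i k} → π i ≡ just k → dom π k ≡ true

_⊆_ : ∀ {m} → PartialMap m → PartialMap m → Set
π′ ⊆ π = ∀ {i k} → π′ i ≡ just k → π i ≡ just k

_⊆ᵘ_ : ∀ {m} → PartialMap m → PartialMap m → Set
τ ⊆ᵘ π = ∀ {i k} → τ i ≡ just k → π i ≡ just k ⊎ π k ≡ just i

⊆ᵘ-⊆-trans : ∀ {m} {τ π′ π : PartialMap m} → τ ⊆ᵘ π′ → π′ ⊆ π → τ ⊆ᵘ π
⊆ᵘ-⊆-trans τ⊆ᵘπ′ π′⊆π e with τ⊆ᵘπ′ e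
... | inj₁ forward  = inj₁ (π′⊆π forward)
... | inj₂ backward = inj₂ (π′⊆π backward)

injective-⊆ : ∀ {m} {π′ π : PartialMap m} → π′ ⊆ π → IsInjective π → IsInjective π′
injective-⊆ π′⊆π inj e e′ = inj (π′⊆π e) (π′⊆π e′)

closed-target-defined : ∀ {m} {τ : PartialMap m} {i k} → IsClosed τ → τ i ≡ just k → τ k ≢ nothing
closed-target-defined closed e τk≡nothing with () ← trans (sym (closed e)) (cong is-just τk≡nothing)

erase : ∀ {m} → Fin m → PartialMap m → PartialMap m
erase i π x with x Fin.≟ i
... | yes _ = nothing
... | no  _ = π x

erase-⊆ : ∀ {m} i (π : PartialMap m) → erase i π ⊆ π
erase-⊆ i π {x} e with x Fin.≟ i
erase-⊆ i π ()    | yes _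
... | no _ = e

erase-self : ∀ {m} i (π : PartialMap m) → erase i π i ≡ nothing
erase-self i π with i Fin.≟ i
... | yes _   = refl
... | no  i≢i = ⊥-elim (i≢i refl)

erase-other : ∀ {m} {i x} (π : PartialMap m) → x ≢ i → erase i π x ≡ π x
erase-other {i = i} {x} π x≢i with x Fin.≟ i
... | yes x≡i = ⊥-elim (x≢i x≡i)
... | no  _   = refl

size-erase : ∀ {m} {i} (π : PartialMap m) → dom π i ≡ true → suc (size (erase i π)) ≡ size π
size-erase {i = i} π i∈dom =
  count-remove i i∈dom (cong is-just (erase-self i π)) (λ x x≢i → cong is-just (erase-other π x≢i))

⊆-nothing : ∀ {m} {π′ π : PartialMap m} {x} → π′ ⊆ π → π x ≡ nothing → π′ x ≡ nothing
⊆-nothing {π′ = π′} {x = x} π′⊆π πx with π′ x in π′x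
... | nothing = refl
... | just _ with () ← trans (sym πx) (π′⊆π π′x)

⊆ᵘ-isolated : ∀ {m} {τ π : PartialMap m} {x} → τ ⊆ᵘ π →
              π x ≡ nothing → (∀ {k} → π k ≢ just x) → τ x ≡ nothing
⊆ᵘ-isolated {τ = τ} {x = x} τ⊆ᵘπ πx ↛x with τ x in τx
... | nothing = refl
... | just _ with τ⊆ᵘπ τx
...   | inj₁ πx≡just with () ← trans (sym πx) πx≡just
...   | inj₂ πk≡x    = ⊥-elim (↛x πk≡x)

lastEdgeAt? : ∀ {m} (π : PartialMap m) p → Dec (∃ λ v → π p ≡ just v × π v ≡ nothing)
lastEdgeAt? π p with π p
... | nothing = no λ { (_ , () , _) }
... | just v with π v in πv
...   | nothing = yes (v , refl , πv)
...   | just _  = no λ { (_ , refl , πv≡nothing) → case trans (sym πv) πv≡nothing of λ () }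

closed-or-lastEdge : ∀ {m} (π : PartialMap m) →
                     IsClosed π ⊎ ∃₂ λ p v → π p ≡ just v × π v ≡ nothing
closed-or-lastEdge π with Finₚ.any? (lastEdgeAt? π)
... | yes (p , v , πp , πv) = inj₂ (p , v , πp , πv)
... | no noLastEdge         = inj₁ closed
  where
  closed : IsClosed π
  closed {i} {k} πi with π k in πk
  ... | just _  = refl
  ... | nothing = ⊥-elim (noLastEdge (i , k , πi , πk))

record Isolation {m} (π : PartialMap m) (p : Fin m) : Set where
  field
    rest      : PartialMap m
    rest-⊆    : rest ⊆ π
    rest-p    : rest p ≡ nothing
    rest-↛p   : ∀ {k} → rest k ≢ just p
    size-rest : size rest < size π
    size-π    : size π ≤ 2 + size rest

-- Besides the edge out of p, at most one edge (into p) is removed, as π is injective.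
isolate : ∀ {m} {π : PartialMap m} {p v} → IsInjective π → π p ≡ just v → v ≢ p → Isolation π p
isolate {π = π} {p} inj πp v≢p with Finₚ.any? (λ q → Maybeₚ.≡-dec Finₚ._≟_ (π q) (just p))
... | no noPred = record
  { rest      = erase p π
  ; rest-⊆    = erase-⊆ p π
  ; rest-p    = erase-self p π
  ; rest-↛p   = λ {k} e → noPred (k , erase-⊆ p π {k} e)
  ; size-rest = ℕₚ.≤-reflexive erased
  ; size-π    = ℕₚ.≤-trans (ℕₚ.≤-reflexive (sym erased)) (ℕₚ.n≤1+n _)
  }
  where
  erased : suc (size (erase p π)) ≡ size π
  erased = size-erase π (cong is-just πp)
... | yes (q , πq) = record
  { rest      = erase q π₁
  ; rest-⊆    = λ {i} e → erase-⊆ p π {i} (erase-⊆ q π₁ {i} e)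
  ; rest-p    = trans (erase-other π₁ (q≢p ∘ sym)) (erase-self p π)
  ; rest-↛p   = λ {k} → rest-↛p {k}
  ; size-rest = ℕₚ.≤-trans (ℕₚ.n≤1+n _) (ℕₚ.≤-reflexive erased)
  ; size-π    = ℕₚ.≤-reflexive (sym erased)
  }
  where
  π₁ = erase p π
  q≢p : q ≢ p
  q≢p refl = v≢p (Maybeₚ.just-injective (trans (sym πp) πq))
  erased : suc (suc (size (erase q π₁))) ≡ size π
  erased = trans (cong suc (size-erase π₁ (cong is-just (trans (erase-other π q≢p) πq))))
                 (size-erase π (cong is-just πp))
  rest-↛p : ∀ {k} → erase q π₁ k ≢ just p
  rest-↛p {k} e with inj {i = k} (erase-⊆ p π {k} (erase-⊆ q π₁ {k} e)) πq
  ... | refl with () ← trans (sym e) (erase-self q π₁)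

addSwap : ∀ {m} → Fin m → Fin m → PartialMap m → PartialMap m
addSwap p v τ x with x Fin.≟ p
... | yes _ = just v
... | no  _ with x Fin.≟ v
...   | yes _ = just p
...   | no  _ = τ x

data SwapView {m} (p v : Fin m) (τ : PartialMap m) (x : Fin m) : Maybe (Fin m) → Set where
  at-p  : x ≡ p → SwapView p v τ x (just v)
  at-v  : x ≡ v → x ≢ p → SwapView p v τ x (just p)
  other : x ≢ p → x ≢ v → SwapView p v τ x (τ x)

swapView : ∀ {m} p v (τ : PartialMap m) x → SwapView p v τ x (addSwap p v τ x)
swapView p v τ x with x Fin.≟ p
... | yes x≡p = at-p x≡p
... | no  x≢p with x Fin.≟ v
...   | yes x≡v = at-v x≡v x≢p
...   | no  x≢v = other x≢p x≢v

addSwap-⊆ᵘ : ∀ {m} {p v} {τ π : PartialMap m} → π p ≡ just v → τ ⊆ᵘ π → addSwap p v τ ⊆ᵘ π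
addSwap-⊆ᵘ {p = p} {v} {τ} πp τ⊆ᵘπ {i} e with addSwap p v τ i | swapView p v τ i
... | _ | at-p refl   rewrite Maybeₚ.just-injective (sym e) = inj₁ πp
... | _ | at-v refl _ rewrite Maybeₚ.just-injective (sym e) = inj₂ πp
... | _ | other _ _   = τ⊆ᵘπ e

module _ {m} {p v : Fin m} {τ : PartialMap m}
         (p≢v : p ≢ v) (τp : τ p ≡ nothing) (τv : τ v ≡ nothing) (closed : IsClosed τ) where

  private
    ↛p : ∀ {x} → τ x ≢ just p
    ↛p e = closed-target-defined closed e τp

    ↛v : ∀ {x} → τ x ≢ just v
    ↛v e = closed-target-defined closed e τv

  addSwap-injective : IsInjective τ → IsInjective (addSwap p v τ)
  addSwap-injective inj {i} {j} ei ej
    with addSwap p v τ i | swapView p v τ i | addSwap p v τ j | swapView p v τ j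
  ... | _ | at-p refl   | _ | at-p refl   = refl
  ... | _ | at-p refl   | _ | at-v refl _ = ⊥-elim (p≢v (Maybeₚ.just-injective (trans ej (sym ei))))
  ... | _ | at-p refl   | _ | other _ _   = ⊥-elim (↛v (trans ej (sym ei)))
  ... | _ | at-v refl _ | _ | at-p refl   = ⊥-elim (p≢v (Maybeₚ.just-injective (trans ei (sym ej))))
  ... | _ | at-v refl _ | _ | at-v refl _ = refl
  ... | _ | at-v refl _ | _ | other _ _   = ⊥-elim (↛p (trans ej (sym ei)))
  ... | _ | other _ _   | _ | at-p refl   = ⊥-elim (↛v (trans ei (sym ej)))
  ... | _ | other _ _   | _ | at-v refl _ = ⊥-elim (↛p (trans ei (sym ej)))
  ... | _ | other _ _   | _ | other _ _   = inj ei ej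

  addSwap-closed : IsClosed (addSwap p v τ)
  addSwap-closed {i} {k} e with addSwap p v τ k | swapView p v τ k
  ... | _ | at-p _   = refl
  ... | _ | at-v _ _ = refl
  ... | _ | other k≢p k≢v with addSwap p v τ i | swapView p v τ i
  ...   | _ | at-p _    = ⊥-elim (k≢v (Maybeₚ.just-injective (sym e)))
  ...   | _ | at-v _ _  = ⊥-elim (k≢p (Maybeₚ.just-injective (sym e)))
  ...   | _ | other _ _ = closed e

  size-addSwap : size (addSwap p v τ) ≡ 2 + size τ
  size-addSwap = begin
    size E                          ≡⟨ sym (size-erase E (swapped v (inj₂ refl))) ⟩
    suc (size (erase v E))          ≡⟨ cong suc (sym (size-erase (erase v E) p∈dom)) ⟩
    2 + size (erase p (erase v E))  ≡⟨ cong (2 +_) (count-cong (cong is-just ∘ erased≗τ)) ⟩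
    2 + size τ                      ∎
    where
    open ≡-Reasoning
    E = addSwap p v τ

    swapped : ∀ x → x ≡ p ⊎ x ≡ v → dom E x ≡ true
    swapped x x∈pv with addSwap p v τ x | swapView p v τ x | x∈pv
    ... | _ | at-p _       | _       = refl
    ... | _ | at-v _ _     | _       = refl
    ... | _ | other x≢p _  | inj₁ x≡p = ⊥-elim (x≢p x≡p)
    ... | _ | other _ x≢v  | inj₂ x≡v = ⊥-elim (x≢v x≡v)

    p∈dom : dom (erase v E) p ≡ true
    p∈dom = trans (cong is-just (erase-other E p≢v)) (swapped p (inj₁ refl))

    unswapped : ∀ {x} → x ≢ p → x ≢ v → E x ≡ τ x
    unswapped {x} x≢p x≢v with addSwap p v τ x | swapView p v τ x
    ... | _ | at-p x≡p   = ⊥-elim (x≢p x≡p)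
    ... | _ | at-v x≡v _ = ⊥-elim (x≢v x≡v)
    ... | _ | other _ _  = refl

    erased≗τ : ∀ x → erase p (erase v E) x ≡ τ x
    erased≗τ x with p Fin.≟ x | v Fin.≟ x
    ... | yes refl | _        = trans (erase-self p (erase v E)) (sym τp)
    ... | no p≢x   | yes refl = trans (erase-other (erase v E) (p≢x ∘ sym)) (trans (erase-self v E) (sym τv))
    ... | no p≢x   | no v≢x   = trans (erase-other (erase v E) (p≢x ∘ sym))
                                      (trans (erase-other E (v≢x ∘ sym)) (unswapped (p≢x ∘ sym) (v≢x ∘ sym)))

-- An injective closed partial map is a permutation of its domain.
record Subpermutation {m} (π : PartialMap m) (s : ℕ) : Set where
  field
    τ         : PartialMap m
    injective : IsInjective τ
    closed    : IsClosed τ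
    size≡     : size τ ≡ s
    ⊆ᵘπ       : τ ⊆ᵘ π

subpermutation-⊆ : ∀ {m} {π′ π : PartialMap m} {s} →
                   π′ ⊆ π → Subpermutation π′ s → Subpermutation π s
subpermutation-⊆ π′⊆π S = record
  { τ = τ ; injective = injective ; closed = closed ; size≡ = size≡
  ; ⊆ᵘπ = ⊆ᵘ-⊆-trans ⊆ᵘπ π′⊆π }
  where open Subpermutation S

subpermutation-empty : ∀ {m} (π : PartialMap m) → Subpermutation π 0
subpermutation-empty {m} π = record
  { τ = λ _ → nothing ; injective = λ () ; closed = λ () ; size≡ = count-false m ; ⊆ᵘπ = λ () }

subpermutation-self : ∀ {m} {π : PartialMap m} → IsInjective π → IsClosed π → Subpermutation π (size π)
subpermutation-self inj closed = record
  { τ = _ ; injective = inj ; closed = closed ; size≡ = refl ; ⊆ᵘπ = inj₁ }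

subpermutation-addLastEdge : ∀ {m} {π : PartialMap m} {p v s} → IsInjective π →
  π p ≡ just v → π v ≡ nothing → (I : Isolation π p) → Subpermutation (Isolation.rest I) s →
  Subpermutation π (2 + s)
subpermutation-addLastEdge {π = π} {p} {v} {s} inj πp πv I S = record
  { τ         = addSwap p v τ
  ; injective = addSwap-injective p≢v τp τv closed injective
  ; closed    = λ {i} → addSwap-closed p≢v τp τv closed {i}
  ; size≡     = trans (size-addSwap p≢v τp τv closed) (cong (2 +_) size≡)
  ; ⊆ᵘπ       = λ {i} → addSwap-⊆ᵘ πp (⊆ᵘ-⊆-trans ⊆ᵘπ rest-⊆) {i}
  }
  where
  open Isolation I
  open Subpermutation S

  p≢v : p ≢ v
  p≢v refl with () ← trans (sym πp) πv

  τp : τ p ≡ nothing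
  τp = ⊆ᵘ-isolated ⊆ᵘπ rest-p rest-↛p

  τv : τ v ≡ nothing
  τv = ⊆ᵘ-isolated ⊆ᵘπ (⊆-nothing (λ {i} → rest-⊆ {i}) πv) rest-↛v
    where
    rest-↛v : ∀ {k} → rest k ≢ just v
    rest-↛v {k} e with inj {i = k} (rest-⊆ {k} e) πp
    ... | refl with () ← trans (sym e) rest-p

evenSubpermutation-acc : ∀ {m} (π : PartialMap m) → Acc _<_ (size π) → IsInjective π →
                         ∀ t → 2 * t ≤ size π → Subpermutation π (2 * t)
evenSubpermutation-acc π _ inj zero _ = subpermutation-empty π
evenSubpermutation-acc π (acc smaller) inj (suc t) 2t≤size with closed-or-lastEdge π
... | inj₂ (p , v , πp , πv) =
  subst (Subpermutation π) (sym (ℕₚ.*-suc 2 t))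
    (subpermutation-addLastEdge inj πp πv I
      (evenSubpermutation-acc rest (smaller size-rest) (injective-⊆ rest-⊆ inj) t 2t≤size-rest))
  where
  v≢p : v ≢ p
  v≢p refl with () ← trans (sym πp) πv
  I = isolate inj πp v≢p
  open Isolation I
  2t≤size-rest : 2 * t ≤ size rest
  2t≤size-rest = ℕₚ.+-cancelˡ-≤ 2 _ _
    (ℕₚ.≤-trans (ℕₚ.≤-reflexive (sym (ℕₚ.*-suc 2 t))) (ℕₚ.≤-trans 2t≤size size-π))
... | inj₁ closed with 2 * suc t ℕₚ.≟ size π
...   | yes 2t≡size = subst (Subpermutation π) (sym 2t≡size) (subpermutation-self inj closed)
...   | no  2t≢size =
  subpermutation-⊆ (erase-⊆ i π)
    (evenSubpermutation-acc (erase i π) (smaller (ℕₚ.≤-reflexive erased))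
      (injective-⊆ (erase-⊆ i π) inj) (suc t) 2t≤size-erased)
  where
  2t<size : 2 * suc t < size π
  2t<size = ℕₚ.≤∧≢⇒< 2t≤size 2t≢size
  nonempty : ∃ λ i → dom π i ≡ true
  nonempty = count-nonempty (dom π) (ℕₚ.≤-trans (s≤s z≤n) 2t<size)
  i = proj₁ nonempty
  erased : suc (size (erase i π)) ≡ size π
  erased = size-erase π (proj₂ nonempty)
  2t≤size-erased : 2 * suc t ≤ size (erase i π)
  2t≤size-erased = ℕₚ.≤-pred (ℕₚ.≤-trans 2t<size (ℕₚ.≤-reflexive (sym erased)))

evenSubpermutation : ∀ {m} {π : PartialMap m} → IsInjective π →
                     ∀ t → 2 * t ≤ size π → Subpermutation π (2 * t)
evenSubpermutation {π = π} = evenSubpermutation-acc π (<-wellFounded (size π))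

enumerate : ∀ {m} (P : Fin m → Bool) → Fin (count P) → Fin m
enumerate {suc m} P a with P fz
enumerate {suc m} P fz     | true  = fz
enumerate {suc m} P (fs a) | true  = fs (enumerate (P ∘ fs) a)
enumerate {suc m} P a      | false = fs (enumerate (P ∘ fs) a)

enumerate-sound : ∀ {m} (P : Fin m → Bool) a → P (enumerate P a) ≡ true
enumerate-sound {suc m} P a with P fz in Pz
enumerate-sound {suc m} P fz     | true  = Pz
enumerate-sound {suc m} P (fs a) | true  = enumerate-sound (P ∘ fs) a
enumerate-sound {suc m} P a      | false = enumerate-sound (P ∘ fs) a

enumerate-complete : ∀ {m} (P : Fin m → Bool) x → P x ≡ true → ∃ λ a → enumerate P a ≡ x
enumerate-complete {suc m} P x Px with P fz in Pz
enumerate-complete {suc m} P fz     Px | true  = fz , refl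
enumerate-complete {suc m} P (fs x) Px | true  with enumerate-complete (P ∘ fs) x Px
... | a , e = fs a , cong fs e
enumerate-complete {suc m} P fz     Px | false with () ← trans (sym Px) Pz
enumerate-complete {suc m} P (fs x) Px | false with enumerate-complete (P ∘ fs) x Px
... | a , e = a , cong fs e

enumerate-mono-< : ∀ {m} (P : Fin m → Bool) {a b} → a Fin.< b → enumerate P a Fin.< enumerate P b
enumerate-mono-< {suc m} P {a} {b} a<b with P fz
enumerate-mono-< {suc m} P {fz}   {fs b} a<b       | true  = s≤s z≤n
enumerate-mono-< {suc m} P {fs a} {fs b} (s≤s a<b) | true  = s≤s (enumerate-mono-< (P ∘ fs) a<b)
enumerate-mono-< {suc m} P               a<b       | false = s≤s (enumerate-mono-< (P ∘ fs) a<b)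

mono-<⇒injective : ∀ {k m} {g : Fin k → Fin m} → (∀ {a b} → a Fin.< b → g a Fin.< g b) →
                   ∀ a b → g a ≡ g b → a ≡ b
mono-<⇒injective mono a b ga≡gb with Finₚ.<-cmp a b
... | tri< a<b _ _ = ⊥-elim (Finₚ.<-irrefl ga≡gb (mono a<b))
... | tri≈ _ a≡b _ = a≡b
... | tri> _ _ b<a = ⊥-elim (Finₚ.<-irrefl (sym ga≡gb) (mono b<a))

record PrincipalSubpermutation {m} (π : PartialMap m) (s : ℕ) : Set where
  field
    index       : Fin s → Fin m
    index-mono  : ∀ a b → a Fin.< b → index a Fin.< index b
    perm        : Fin s → Fin s
    perm-isPerm : IsPerm perm
    edge        : ∀ a → π (index a) ≡ just (index (perm a)) ⊎ π (index (perm a)) ≡ just (index a)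

principalSubpermutation : ∀ {m} {π : PartialMap m} {s} → Subpermutation π s → PrincipalSubpermutation π s
principalSubpermutation record { τ = τ ; injective = inj ; closed = closed ; size≡ = refl ; ⊆ᵘπ = ⊆ᵘπ } =
  record
  { index       = index
  ; index-mono  = λ a b → enumerate-mono-< (dom τ)
  ; perm        = perm
  ; perm-isPerm = perm-isPerm
  ; edge        = λ a → ⊆ᵘπ (τ-index a)
  }
  where
  index = enumerate (dom τ)

  image : ∀ a → ∃ λ b → τ (index a) ≡ just (index b)
  image a with τ (index a) in τa | enumerate-sound (dom τ) a
  ... | just y | _ with enumerate-complete (dom τ) y (closed τa)
  ...   | b , refl = b , refl

  perm : Fin (size τ) → Fin (size τ)
  perm = proj₁ ∘ image

  τ-index : ∀ a → τ (index a) ≡ just (index (perm a))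
  τ-index = proj₂ ∘ image

  perm-isPerm : IsPerm perm
  perm-isPerm a b pa≡pb = mono-<⇒injective (enumerate-mono-< (dom τ)) a b
    (inj (τ-index a) (trans (τ-index b) (cong (just ∘ index) (sym pa≡pb))))

allFuns-complete : ∀ m k (f : Fin m → Fin k) → Any (λ g → ∀ i → g i ≡ f i) (allFuns m k)
allFuns-complete zero    k f = here λ ()
allFuns-complete (suc m) k f =
  Anyₚ.concatMap⁺ _ (Any.map (λ g≗f∘fs → Anyₚ.map⁺ (Any.map (cons-≗ g≗f∘fs) (∈-allFin (f fz))))
                           (allFuns-complete m k (f ∘ fs)))
  where
  cons-≗ : ∀ {g x} → (∀ i → g i ≡ f (fs i)) → f fz ≡ x → ∀ i → (x Vec.∷ g) i ≡ f i
  cons-≗ g≗f∘fs f0≡x fz     = sym f0≡x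
  cons-≗ g≗f∘fs f0≡x (fs i) = g≗f∘fs i

isPerm-≗ : ∀ {m} {τ σ : Fin m → Fin m} → (∀ i → τ i ≡ σ i) → IsPerm σ → IsPerm τ
isPerm-≗ τ≗σ σ-perm i j τi≡τj = σ-perm i j (trans (sym (τ≗σ i)) (trans τi≡τj (τ≗σ j)))

permutations-complete : ∀ {m} {σ : Fin m → Fin m} → IsPerm σ →
                        Any (λ τ → ∀ i → τ i ≡ σ i) (permutations m)
permutations-complete {m} {σ} σ-perm with Anyₚ.filter⁺ isPerm? (allFuns-complete m m σ)
... | inj₁ found = found
... | inj₂ notPerm = ⊥-elim (notPerm (isPerm-≗ (Anyₚ.lookup-result (allFuns-complete m m σ)) σ-perm))

module OrderedFieldProperties {c ℓ₁ ℓ₂} (F : OrderedField c ℓ₁ ℓ₂) where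

  open OrderedField F hiding (zero)
    renaming (_+_ to _+ᶠ_; _*_ to _*ᶠ_; _≤_ to _≤ᶠ_; refl to ≈-refl; sym to ≈-sym; trans to ≈-trans)
  open Matrices commutativeRing
  open import Algebra.Properties.Ring ring using (-1*x≈-x; -‿involutive)
  open import Relation.Binary.Reasoning.Setoid setoid

  private
    module ≤ᶠ = IsTotalOrder isTotalOrder

  *-nonzero : ∀ {a b} → a ≉ 0# → b ≉ 0# → a *ᶠ b ≉ 0#
  *-nonzero {a} {b} a≉0 b≉0 ab≈0 with inverse a a≉0
  ... | a⁻¹ , aa⁻¹≈1 = b≉0 (begin
    b               ≈⟨ *-identityˡ b ⟨
    1# *ᶠ b         ≈⟨ *-congʳ aa⁻¹≈1 ⟨
    (a *ᶠ a⁻¹) *ᶠ b ≈⟨ *-congʳ (*-comm a a⁻¹) ⟩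
    (a⁻¹ *ᶠ a) *ᶠ b ≈⟨ *-assoc a⁻¹ a b ⟩
    a⁻¹ *ᶠ (a *ᶠ b) ≈⟨ *-congˡ ab≈0 ⟩
    a⁻¹ *ᶠ 0#       ≈⟨ zeroʳ a⁻¹ ⟩
    0#              ∎)

  0≤1 : 0# ≤ᶠ 1#
  0≤1 with ≤ᶠ.total 0# 1#
  ... | inj₁ 0≤1 = 0≤1
  ... | inj₂ 1≤0 = ≤ᶠ.≤-respʳ-≈ -1*-1≈1 (*-nonneg 0≤-1 0≤-1)
    where
    0≤-1 : 0# ≤ᶠ (- 1#)
    0≤-1 = ≤ᶠ.≤-respʳ-≈ (+-identityˡ (- 1#)) (≤ᶠ.≤-respˡ-≈ (-‿inverseʳ 1#) (+-monoˡ-≤ (- 1#) 1≤0))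
    -1*-1≈1 : - 1# *ᶠ - 1# ≈ 1#
    -1*-1≈1 = ≈-trans (-1*x≈-x (- 1#)) (-‿involutive 1#)

  x≤x+y : ∀ {x y} → 0# ≤ᶠ y → x ≤ᶠ (x +ᶠ y)
  x≤x+y {x} {y} 0≤y = ≤ᶠ.≤-respʳ-≈ (+-comm y x) (≤ᶠ.≤-respˡ-≈ (+-identityˡ x) (+-monoˡ-≤ x 0≤y))

  prodFin-nonzero : ∀ m (g : Fin m → Carrier) → (∀ i → g i ≉ 0#) → prodFin m g ≉ 0#
  prodFin-nonzero zero    g g≉0 = 0≉1 ∘ ≈-sym
  prodFin-nonzero (suc m) g g≉0 = *-nonzero (g≉0 fz) (prodFin-nonzero m (g ∘ fs) (g≉0 ∘ fs))

  prodFin-nonzero⁻ : ∀ m (g : Fin m → Carrier) → prodFin m g ≉ 0# → ∀ i → g i ≉ 0#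
  prodFin-nonzero⁻ (suc m) g prod≉0 fz     g0≈0 = prod≉0 (≈-trans (*-congʳ g0≈0) (zeroˡ _))
  prodFin-nonzero⁻ (suc m) g prod≉0 (fs i) =
    prodFin-nonzero⁻ m (g ∘ fs) (λ rest≈0 → prod≉0 (≈-trans (*-congˡ rest≈0) (zeroʳ _))) i

  prodFin-nonneg : ∀ m (g : Fin m → Carrier) → (∀ i → 0# ≤ᶠ g i) → 0# ≤ᶠ prodFin m g
  prodFin-nonneg zero    g 0≤g = 0≤1
  prodFin-nonneg (suc m) g 0≤g = *-nonneg (0≤g fz) (prodFin-nonneg m (g ∘ fs) (0≤g ∘ fs))

  prodFin-cong : ∀ m {g h : Fin m → Carrier} → (∀ i → g i ≡ h i) → prodFin m g ≡ prodFin m h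
  prodFin-cong zero    g≗h = refl
  prodFin-cong (suc m) g≗h = cong₂ _*ᶠ_ (g≗h fz) (prodFin-cong m (g≗h ∘ fs))

  module _ {a} {A : Set a} (h : A → Carrier) where

    sumL-nonneg : (∀ x → 0# ≤ᶠ h x) → ∀ xs → 0# ≤ᶠ sumL (map h xs)
    sumL-nonneg 0≤h []       = ≤ᶠ.refl
    sumL-nonneg 0≤h (x ∷ xs) = ≤ᶠ.trans (0≤h x) (x≤x+y (sumL-nonneg 0≤h xs))

    ≤-sumL : (∀ x → 0# ≤ᶠ h x) → ∀ {t} xs → Any (λ x → t ≤ᶠ h x) xs → t ≤ᶠ sumL (map h xs)
    ≤-sumL 0≤h (x ∷ xs) (here t≤hx) = ≤ᶠ.trans t≤hx (x≤x+y (sumL-nonneg 0≤h xs))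
    ≤-sumL 0≤h (x ∷ xs) (there any) =
      ≤ᶠ.trans (≤-sumL 0≤h xs any) (≤ᶠ.≤-respˡ-≈ (+-identityˡ _) (+-monoˡ-≤ (sumL (map h xs)) (0≤h x)))

    sumL-nonzero : ∀ xs → sumL (map h xs) ≉ 0# → ¬ ¬ Any (λ x → h x ≉ 0#) xs
    sumL-nonzero []       sum≉0 _    = sum≉0 ≈-refl
    sumL-nonzero (x ∷ xs) sum≉0 none = none (here λ hx≈0 →
      sumL-nonzero xs (λ rest≈0 → sum≉0 (≈-trans (+-cong hx≈0 rest≈0) (+-identityˡ 0#))) (none ∘ there))

  per-nonzero⇒diagonal : ∀ {m} (M : Matrix m) → per M ≉ 0# →
                         ¬ ¬ ∃ λ σ → IsPerm σ × (∀ i → M i (σ i) ≉ 0#)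
  per-nonzero⇒diagonal {m} M per≉0 noDiagonal =
    sumL-nonzero term (permutations m) per≉0 λ nonzeroTerm →
      let σ-perm , term≉0 = lookupAny (all-filter isPerm? (allFuns m m)) nonzeroTerm
      in  noDiagonal (Any.lookup nonzeroTerm , σ-perm , prodFin-nonzero⁻ m _ term≉0)
    where
    term : (Fin m → Fin m) → Carrier
    term σ = prodFin m (λ i → M i (σ i))

  diagonal⇒per-nonzero : ∀ {m} (M : Matrix m) → (∀ i j → 0# ≤ᶠ M i j) →
                         ∀ {σ} → IsPerm σ → (∀ i → M i (σ i) ≉ 0#) → per M ≉ 0#
  diagonal⇒per-nonzero {m} M 0≤M {σ} σ-perm diagonal≉0 per≈0 =
    prodFin-nonzero m _ diagonal≉0 (≤ᶠ.antisym (≤ᶠ.≤-respʳ-≈ per≈0 term-σ≤per) (0≤term σ))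
    where
    term : (Fin m → Fin m) → Carrier
    term τ = prodFin m (λ i → M i (τ i))
    0≤term : ∀ τ → 0# ≤ᶠ term τ
    0≤term τ = prodFin-nonneg m _ (λ i → 0≤M i (τ i))
    term-σ≤ : ∀ {τ} → (∀ i → τ i ≡ σ i) → term σ ≤ᶠ term τ
    term-σ≤ τ≗σ = ≤ᶠ.reflexive (reflexive (prodFin-cong m (λ i → cong (M i) (sym (τ≗σ i)))))
    term-σ≤per : term σ ≤ᶠ per M
    term-σ≤per = ≤-sumL term 0≤term (permutations m) (Any.map term-σ≤ (permutations-complete σ-perm))

module _ {c ℓ₁ ℓ₂} (F : OrderedField c ℓ₁ ℓ₂) where

  open OrderedField F using (0#; _≉_) renaming (_≤_ to _≤ᶠ_; trans to ≈-trans)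
  open Matrices (OrderedField.commutativeRing F)
  open OrderedFieldProperties F using (per-nonzero⇒diagonal; diagonal⇒per-nonzero)

  ppr-even : ∀ {n} (A : Matrix n) → (∀ i j → 0# ≤ᶠ A i j) → SymmetricMatrix A →
             ∀ t {j} → 2 * suc t ≤ suc j → ppr A (suc j) → ¬ ¬ ppr A (2 * suc t)
  ppr-even A 0≤A A-sym t {j} 2t≤j (f , f-mono , per≉0) =
    ¬¬-map principal (per-nonzero⇒diagonal (principalSub A f) per≉0)
    where
    principal : (∃ λ σ → IsPerm σ × (∀ i → A (f i) (f (σ i)) ≉ 0#)) → ppr A (2 * suc t)
    principal (σ , σ-perm , σ-nonzero) =
      f ∘ index , (λ a b → f-mono _ _ ∘ index-mono a b) ,
      diagonal⇒per-nonzero (principalSub A (f ∘ index)) (λ _ _ → 0≤A _ _) perm-isPerm nonzero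
      where
      π : PartialMap (suc j)
      π = just ∘ σ
      π-injective : IsInjective π
      π-injective e e′ = σ-perm _ _ (Maybeₚ.just-injective (trans e (sym e′)))
      open PrincipalSubpermutation
        (principalSubpermutation (evenSubpermutation π-injective (suc t)
          (ℕₚ.≤-trans 2t≤j (ℕₚ.≤-reflexive (sym (count-true (suc j)))))))
      π-edge-nonzero : ∀ {x y} → π x ≡ just y → A (f x) (f y) ≉ 0#
      π-edge-nonzero {x} e with refl ← Maybeₚ.just-injective e = σ-nonzero x
      nonzero : ∀ a → A (f (index a)) (f (index (perm a))) ≉ 0#
      nonzero a with edge a
      ... | inj₁ e = π-edge-nonzero e
      ... | inj₂ e = π-edge-nonzero e ∘ ≈-trans (A-sym _ _)

lemma4p1 : {c ℓ₁ ℓ₂ : Level} (F : OrderedField c ℓ₁ ℓ₂) →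
    (n : ℕ) (A : Matrices.Matrix (OrderedField.commutativeRing F) n) →
    (∀ i j → OrderedField._≤_ F (OrderedField.0# F) (A i j)) →
    Matrices.SymmetricMatrix (OrderedField.commutativeRing F) A →
    (k : ℕ) → 0 < k → 2 * k ≤ n →
    ¬ Matrices.ppr (OrderedField.commutativeRing F) A (2 * k) →
    ∀ j → 2 * k ≤ j → j ≤ n → ¬ Matrices.ppr (OrderedField.commutativeRing F) A j
lemma4p1 F n A 0≤A A-sym zero () _ _ _ _ _
lemma4p1 F n A 0≤A A-sym (suc t) _ _ _ zero () _
lemma4p1 F n A 0≤A A-sym (suc t) _ _ ¬r₂ₖ (suc j) 2k≤j _ rⱼ =
  ppr-even F A 0≤A A-sym t 2k≤j rⱼ ¬r₂ₖ
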